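{- Let $n\ge1$, $k\ge2$. In any play $s_0,s_1,\dots$ of the infinite $(n,k)$-shift-game in which Alice applies the strategy $A_{tail}$ and Bob applies a strategy $B$, if $t_0<t_1<t_2$ are indices of the play such that $B(s_{t_0})=B(s_{t_2})=1$, $A_{tail}(s_{t_1})=1$, and $B(s_t)=0$ for all $t_0<t<t_2$, then for all $t_1<t'\le t_2$ the state $s_{t'}$ is of the form $0x$ for some $x\in[k]^{n-1}$.
   Context: $[k]=\{0,\dots,k-1\}$; words written by concatenation. A strategy for Bob is $B\colon[k]^n\to\{0,1\}$ with $B(x(k-1))=0$ for all $x\in[k]^{n-1}$; a strategy for Alice is $A\colon[k]^n\to\{0,1\}$ with $A(x0)=0$ for all $x$. The infinite $(n,k)$-shift-game: a play is a (finite or infinite) sequence $s_0,s_1,\dots$ with $s_0=0^n$ and, if $s_t=x\sigma$, then $s_{t+1}=(\sigma+1)x$ if $B(s_t)=1$; $s_{t+1}=0x$ if $B(s_t)=0$ and $A(s_t)=1$; $s_{t+1}=\sigma x$ otherwise; the play stops only at the first $m>0$ with $s_m=0^n$ (Alice then wins); if this never happens the play is infinite and Bob wins. For $s=\sigma_0\cdots\sigma_{n-1}\in[k]^n$ and $0\le m<n$: $val(s,m)=\sum_{i=1}^n \sigma_{(m-i)\bmod n}k^{i-1}$; $head(s)=\min\{m : val(s,m)=\max_{m'} val(s,m')\}$; for $s\ne0^n$, $tail(s)=\big(\max\{i\in\mathbb{Z} : i<head(s),\ \sigma_{i\bmod n}\ne0\}\big)\bmod n$. $A_{tail}(s)=1$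 if $s\ne0^n$ and $tail(s)=n-1$, and $A_{tail}(s)=0$ otherwise. -}

module Defs where

open import Data.Nat using (ℕ; zero; suc; _+_; _*_; _∸_; _^_; _<_; _<?_; _≡ᵇ_; _⊔_)
open import Data.Nat.DivMod using (_%_; m%n<n)
open import Data.Fin using (Fin; toℕ; fromℕ<; fromℕ)
open import Data.Vec using (Vec; _∷_; []; replicate; lookup; last; init; _∷ʳ_)
open import Data.Vec.Properties using ()
open import Data.Bool using (Bool; true; false; if_then_else_; _∧_; not)
open import Data.Product using (∃; _×_)
open import Function using (_∘_)
open import Relation.Nullary using (¬_; yes; no)
open import Relation.Nullary.Decidable using (⌊_⌋)
open import Relation.Binary.PropositionalEquality using (_≡_)

-- Throughout: n = suc m (so n ≥ 1) and k = suc (suc j) (so k ≥ 2).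
-- A word in [k]^n is a Vec (Fin k) n; position i is  lookup s i.

Word : ℕ → ℕ → Set
Word m j = Vec (Fin (suc (suc j))) (suc m)

zeros : ∀ {m j} → Word m j
zeros = replicate _ Fin.zero
  where import Data.Fin as Fin

letter : ∀ {m j} → Word m j → ℕ → ℕ
letter {m} s i = toℕ (lookup s (fromℕ< (m%n<n i (suc m))))

sum1 : ℕ → (ℕ → ℕ) → ℕ
sum1 zero    f = 0
sum1 (suc c) f = sum1 c f + f (suc c)

-- val(s,p) = Σ_{i=1}^n σ_{(p-i) mod n} k^{i-1}   (for p < n, (p-i) mod n = (p+n-i) mod n)
val : ∀ {m j} → Word m j → ℕ → ℕ
val {m} {j} s p = sum1 (suc m) (λ i → letter s (p + suc m ∸ i) * (suc (suc j)) ^ (i ∸ 1))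

maxBelow : ℕ → (ℕ → ℕ) → ℕ
maxBelow zero    f = 0
maxBelow (suc c) f = maxBelow c f ⊔ f c

-- least p < c with P p, and c if there is none
firstBelow : ℕ → (ℕ → Bool) → ℕ
firstBelow zero    P = 0
firstBelow (suc c) P with firstBelow c P
... | r = if (r ≡ᵇ c) then (if P c then c else suc c) else r

headPos : ∀ {m j} → Word m j → ℕ
headPos {m} s = firstBelow (suc m) (λ p → val s p ≡ᵇ maxBelow (suc m) (val s))

-- tail(s) = (max { i ∈ ℤ : i < head(s), σ_{i mod n} ≠ 0 }) mod n.
-- Writing i = head(s) - d with d ≥ 1: d is the least d ∈ {1,…,n} with
-- σ_{(head - d) mod n} ≠ 0 (exists when s ≠ 0^n, and the set is n-periodic),
-- and (head - d) mod n = (head + n - d) mod n.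
tailPos : ∀ {m j} → Word m j → ℕ
tailPos {m} s =
  let h = headPos s
      d = suc (firstBelow (suc m) (λ e → not (letter s (h + suc m ∸ suc e) ≡ᵇ 0)))
  in (h + suc m ∸ d) % suc m

isZeroWord : ∀ {m j} → Word m j → Bool
isZeroWord s = ⌊ s ≟ᵛ zeros ⌋
  where
  open import Data.Vec.Properties using (≡-dec)
  open import Data.Fin.Properties using (_≟_)
  _≟ᵛ_ = ≡-dec _≟_

Atail : ∀ {m j} → Word m j → Bool
Atail {m} s = not (isZeroWord s) ∧ (tailPos s ≡ᵇ m)

IsBobStrategy : ∀ {m j} → (Word m j → Bool) → Set
IsBobStrategy {m} {j} B = ∀ (x : Vec (Fin (suc (suc j))) m) → B (x ∷ʳ fromℕ (suc j)) ≡ false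

-- σ+1 in [k]; (the wrap-around branch is never used by a Bob strategy)
inc : ∀ {j} → Fin (suc (suc j)) → Fin (suc (suc j))
inc {j} σ with suc (toℕ σ) <? suc (suc j)
... | yes p = fromℕ< p
... | no _  = Fin.zero
  where import Data.Fin as Fin

step : ∀ {m j} → (Word m j → Bool) → (Word m j → Bool) → Word m j → Word m j
step B A s =
  if B s then inc (last s) ∷ init s
  else if A s then Fin.zero ∷ init s
  else last s ∷ init s
  where import Data.Fin as Fin

state : ∀ {m j} → (Word m j → Bool) → (Word m j → Bool) → ℕ → Word m j
state B A zero    = zeros
state B A (suc t) = step B A (state B A t)

-- t is an index of the play: the play has not stopped before t, i.e.
-- s_{t'} ≠ 0^n for all 0 < t' < t
IsIndex : ∀ {m j} → (Word m j → Bool) → (Word m j → Bool) → ℕ → Set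
IsIndex B A t = ∀ t' → 0 < t' → t' < t → ¬ (state B A t' ≡ zeros)

module Submission where

-- While Bob passes, A_tail keeps every letter before the head equal to 0.
-- Under this invariant a passing move is always s ↦ 0 · init s: if the last
-- letter is nonzero it is the tail, so A_tail fires; otherwise the rotation
-- itself moves a 0 to the front.  The invariant survives that move because
-- its head advances by at most one: val (0 · init s) is maximal at head + 1,
-- since up to there it only gains leading zeros (multiplying val by powers
-- of k), and beyond it val (0 · init s) (p + 1) = val s p − σ_{n-1} k^p.
-- Once A_tail fires at t₁ the invariant holds, hence every later state
-- before Bob's next move starts with 0.

open import Defs
open import Data.Nat using (ℕ; zero; suc; _+_; _*_; _∸_; _^_; _<_; _≤_; z≤n; s≤s; z<s; s≤s⁻¹; _≡ᵇ_; _≟_; _≤?_; _<?_)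
open import Data.Nat.Properties
open import Algebra.Properties.CommutativeSemigroup +-commutativeSemigroup using (xy∙z≈xz∙y)
open import Data.Nat.DivMod using (_%_; m%n<n; [m+n]%n≡m%n; m≤n⇒[n∸m]%m≡n%m; m<n⇒m%n≡m; m≤n⇒m%n≡m; %-distribˡ-+)
open import Data.Fin as Fin using (Fin; toℕ; fromℕ<; fromℕ; inject₁)
open import Data.Fin.Properties using (toℕ-injective; toℕ-fromℕ<; toℕ-fromℕ; toℕ-inject₁) renaming (_≟_ to _≟ᶠ_)
open import Data.Vec using (Vec; _∷_; []; lookup; last; init)
open import Data.Vec.Properties using (≡-dec)
open import Data.Bool using (Bool; true; false; not; _∧_; T)
open import Data.Bool.Properties using (∧-conicalʳ)
open import Data.Product using (∃; _×_; _,_)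
open import Data.Sum using (inj₁; inj₂)
open import Function using (_∘_)
open import Relation.Nullary using (Dec; yes; no; contradiction)
open import Relation.Nullary.Decidable using (isYes≗does; dec-false)
open import Relation.Binary.PropositionalEquality

≡ᵇ-refl : ∀ n → (n ≡ᵇ n) ≡ true
≡ᵇ-refl zero    = refl
≡ᵇ-refl (suc n) = ≡ᵇ-refl n

≡ᵇ-true⇒≡ : ∀ {m n} → (m ≡ᵇ n) ≡ true → m ≡ n
≡ᵇ-true⇒≡ {m} {n} eq = ≡ᵇ⇒≡ m n (subst T (sym eq) _)

≢0⇒not[≡ᵇ0] : ∀ {x} → x ≢ 0 → not (x ≡ᵇ 0) ≡ true
≢0⇒not[≡ᵇ0] {zero}  x≢0 = contradiction refl x≢0
≢0⇒not[≡ᵇ0] {suc x} _   = refl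

not[≡ᵇ0]≡false⇒≡0 : ∀ {x} → not (x ≡ᵇ 0) ≡ false → x ≡ 0
not[≡ᵇ0]≡false⇒≡0 {zero} _ = refl

lookup-init : ∀ {A : Set} {n} (xs : Vec A (suc n)) (i : Fin n) →
              lookup (init xs) i ≡ lookup xs (inject₁ i)
lookup-init (x ∷ y ∷ xs) Fin.zero    = refl
lookup-init (x ∷ y ∷ xs) (Fin.suc i) = lookup-init (y ∷ xs) i

lookup-fromℕ : ∀ {A : Set} {n} (xs : Vec A (suc n)) → lookup xs (fromℕ n) ≡ last xs
lookup-fromℕ (x ∷ [])     = refl
lookup-fromℕ (x ∷ y ∷ xs) = lookup-fromℕ (y ∷ xs)

m+n+o∸n≡m+o : ∀ m n o → m + n + o ∸ n ≡ m + o
m+n+o∸n≡m+o m n o = begin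
  m + n + o ∸ n  ≡⟨ +-∸-comm o (m≤n+m n m) ⟩
  m + n ∸ n + o  ≡⟨ cong (_+ o) (m+n∸n≡m m n) ⟩
  m + o          ∎
  where open ≡-Reasoning

m+[1+n]∸[1+m]≡n : ∀ m n → m + suc n ∸ suc m ≡ n
m+[1+n]∸[1+m]≡n m n = trans (cong (_∸ suc m) (+-suc m n)) (m+n∸m≡n (suc m) n)

x%[1+m]≡m⇒x≡m : ∀ {m x} → x < m + suc m → x % suc m ≡ m → x ≡ m
x%[1+m]≡m⇒x≡m {m} {x} x<m+1+m x%≡m with x <? suc m
... | yes x<1+m = trans (sym (m<n⇒m%n≡m x<1+m)) x%≡m
... | no  x≮1+m = contradiction y≡m (<⇒≢ y<m)
  where
  1+m≤x : suc m ≤ x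
  1+m≤x = ≮⇒≥ x≮1+m
  y : ℕ
  y = x ∸ suc m
  y<m : y < m
  y<m = +-cancelʳ-< (suc m) y m (subst (_< m + suc m) (sym (m∸n+n≡m 1+m≤x)) x<m+1+m)
  y≡m : y ≡ m
  y≡m = trans (sym (m<n⇒m%n≡m (m<n⇒m<1+n y<m))) (trans (m≤n⇒[n∸m]%m≡n%m 1+m≤x) x%≡m)

module _ {m j : ℕ} (s : Word m j) where
  open ≡-Reasoning

  letter-lookup : ∀ x (i : Fin (suc m)) → toℕ i ≡ x % suc m → letter s x ≡ toℕ (lookup s i)
  letter-lookup x i i≡x% = cong (λ z → toℕ (lookup s z)) (toℕ-injective (trans (toℕ-fromℕ< _) (sym i≡x%)))

  letter-+n : ∀ x → letter s (x + suc m) ≡ letter s x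
  letter-+n x = letter-lookup (x + suc m) _ (trans (toℕ-fromℕ< _) (sym ([m+n]%n≡m%n x (suc m))))

  letter-last : letter s m ≡ toℕ (last s)
  letter-last = begin
    letter s m              ≡⟨ letter-lookup m (fromℕ m) (trans (toℕ-fromℕ m) (sym (m≤n⇒m%n≡m ≤-refl))) ⟩
    toℕ (lookup s (fromℕ m)) ≡⟨ cong toℕ (lookup-fromℕ s) ⟩
    toℕ (last s)            ∎

shift₀ : ∀ {m j} → Word m j → Word m j
shift₀ s = Fin.zero ∷ init s

module _ {m j : ℕ} (s : Word m j) where
  open ≡-Reasoning

  shift₀-letter-0 : letter (shift₀ s) 0 ≡ 0
  shift₀-letter-0 = letter-lookup (shift₀ s) 0 Fin.zero refl

  shift₀-letter-suc : ∀ x → x % suc m ≢ m → letter (shift₀ s) (suc x) ≡ letter s x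
  shift₀-letter-suc x r≢m = begin
    letter (shift₀ s) (suc x)  ≡⟨ letter-lookup (shift₀ s) (suc x) (Fin.suc i) 1+i≡ ⟩
    toℕ (lookup (init s) i)    ≡⟨ cong toℕ (lookup-init s i) ⟩
    toℕ (lookup s (inject₁ i)) ≡⟨ letter-lookup s x (inject₁ i) (trans (toℕ-inject₁ i) (toℕ-fromℕ< r<m)) ⟨
    letter s x                 ∎
    where
    r : ℕ
    r = x % suc m
    r<m : r < m
    r<m = ≤∧≢⇒< (s≤s⁻¹ (m%n<n x (suc m))) r≢m
    i : Fin m
    i = fromℕ< r<m
    1+i≡ : suc (toℕ i) ≡ suc x % suc m
    1+i≡ = begin
      suc (toℕ i)              ≡⟨ cong suc (toℕ-fromℕ< r<m) ⟩
      suc r                    ≡⟨ m≤n⇒m%n≡m r<m ⟨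
      suc r % suc m            ≡⟨ cong (λ z → (z + r) % suc m) (m≤n⇒m%n≡m (≤-trans (s≤s z≤n) r<m)) ⟨
      (1 % suc m + r) % suc m  ≡⟨ %-distribˡ-+ 1 x (suc m) ⟨
      suc x % suc m            ∎

sum1-cong : ∀ c {f g : ℕ → ℕ} → (∀ i → 1 ≤ i → i ≤ c → f i ≡ g i) → sum1 c f ≡ sum1 c g
sum1-cong zero    f≗g = refl
sum1-cong (suc c) f≗g =
  cong₂ _+_ (sum1-cong c (λ i 1≤i i≤c → f≗g i 1≤i (m≤n⇒m≤1+n i≤c))) (f≗g (suc c) (s≤s z≤n) ≤-refl)

sum1-unconsˡ : ∀ c (f : ℕ → ℕ) → sum1 (suc c) f ≡ f 1 + sum1 c (λ i → f (suc i))
sum1-unconsˡ zero    f = +-comm 0 (f 1)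
sum1-unconsˡ (suc c) f = trans (cong (_+ f (suc (suc c))) (sum1-unconsˡ c f)) (+-assoc (f 1) _ _)

sum1-*ˡ : ∀ c a (f : ℕ → ℕ) → sum1 c (λ i → a * f i) ≡ a * sum1 c f
sum1-*ˡ zero    a f = sym (*-zeroʳ a)
sum1-*ˡ (suc c) a f = trans (cong (_+ a * f (suc c)) (sum1-*ˡ c a f)) (sym (*-distribˡ-+ a _ _))

sum1-differ-at : ∀ c (f g : ℕ → ℕ) {e} → 1 ≤ e → e ≤ c →
                 (∀ i → 1 ≤ i → i ≤ c → i ≢ e → f i ≡ g i) →
                 sum1 c f + g e ≡ sum1 c g + f e
sum1-differ-at zero    f g (s≤s _) ()
sum1-differ-at (suc c) f g {e} 1≤e e≤1+c f≗g with m≤n⇒m<n∨m≡n e≤1+c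
... | inj₂ refl = begin
  sum1 c f + f (suc c) + g (suc c)  ≡⟨ xy∙z≈xz∙y (sum1 c f) _ _ ⟩
  sum1 c f + g (suc c) + f (suc c)  ≡⟨ cong (λ a → a + g (suc c) + f (suc c)) (sum1-cong c f≗g-below) ⟩
  sum1 c g + g (suc c) + f (suc c)  ∎
  where
  open ≡-Reasoning
  f≗g-below : ∀ i → 1 ≤ i → i ≤ c → f i ≡ g i
  f≗g-below i 1≤i i≤c = f≗g i 1≤i (m≤n⇒m≤1+n i≤c) (<⇒≢ (s≤s i≤c))
... | inj₁ e<1+c = begin
  sum1 c f + f (suc c) + g e  ≡⟨ xy∙z≈xz∙y (sum1 c f) _ _ ⟩
  sum1 c f + g e + f (suc c)  ≡⟨ cong₂ _+_ ih (f≗g (suc c) (s≤s z≤n) ≤-refl (≢-sym (<⇒≢ e<1+c))) ⟩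
  sum1 c g + f e + g (suc c)  ≡⟨ xy∙z≈xz∙y (sum1 c g) _ _ ⟩
  sum1 c g + g (suc c) + f e  ∎
  where
  open ≡-Reasoning
  ih : sum1 c f + g e ≡ sum1 c g + f e
  ih = sum1-differ-at c f g 1≤e (s≤s⁻¹ e<1+c) (λ i 1≤i i≤c → f≗g i 1≤i (m≤n⇒m≤1+n i≤c))

module _ {m j : ℕ} (s : Word m j) where
  open ≡-Reasoning
  private
    k : ℕ
    k = suc (suc j)

  val-suc : ∀ q → letter s q ≡ 0 → val s (suc q) ≡ k * val s q
  val-suc q σq≡0 = begin
    val s (suc q)                        ≡⟨ sum1-unconsˡ m F ⟩
    F 1 + sum1 m (λ i → F (suc i))       ≡⟨ cong (_+ sum1 m (λ i → F (suc i))) F1≡0 ⟩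
    sum1 m (λ i → F (suc i))             ≡⟨ sum1-cong m F[1+i]≡kG ⟩
    sum1 m (λ i → k * G i)               ≡⟨ sum1-*ˡ m k G ⟩
    k * sum1 m G                         ≡⟨ cong (k *_) (+-identityʳ (sum1 m G)) ⟨
    k * (sum1 m G + 0)                   ≡⟨ cong (λ z → k * (sum1 m G + z)) G[1+m]≡0 ⟨
    k * val s q                          ∎
    where
    F G : ℕ → ℕ
    F i = letter s (suc q + suc m ∸ i) * k ^ (i ∸ 1)
    G i = letter s (q + suc m ∸ i) * k ^ (i ∸ 1)
    F1≡0 : F 1 ≡ 0
    F1≡0 = cong (_* 1) (trans (letter-+n s q) σq≡0)
    G[1+m]≡0 : G (suc m) ≡ 0
    G[1+m]≡0 = cong (_* k ^ m) (trans (cong (letter s) (m+n∸n≡m q (suc m))) σq≡0)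
    F[1+i]≡kG : ∀ i → 1 ≤ i → i ≤ m → F (suc i) ≡ k * G i
    F[1+i]≡kG (suc i) _ _ = begin
      σ * (k * k ^ i)  ≡⟨ *-assoc σ k _ ⟨
      σ * k * k ^ i    ≡⟨ cong (_* k ^ i) (*-comm σ k) ⟩
      k * σ * k ^ i    ≡⟨ *-assoc k σ _ ⟩
      k * (σ * k ^ i)  ∎
      where σ = letter s (q + suc m ∸ suc i)

  val-+-zeros : ∀ p d → (∀ e → e < d → letter s (p + e) ≡ 0) → val s (p + d) ≡ k ^ d * val s p
  val-+-zeros p zero    _     = trans (cong (val s) (+-identityʳ p)) (sym (+-identityʳ _))
  val-+-zeros p (suc d) σ≡0 = begin
    val s (p + suc d)      ≡⟨ cong (val s) (+-suc p d) ⟩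
    val s (suc (p + d))    ≡⟨ val-suc (p + d) (σ≡0 d ≤-refl) ⟩
    k * val s (p + d)      ≡⟨ cong (k *_) (val-+-zeros p d (λ e e<d → σ≡0 e (m≤n⇒m≤1+n e<d))) ⟩
    k * (k ^ d * val s p)  ≡⟨ *-assoc k (k ^ d) (val s p) ⟨
    k ^ suc d * val s p    ∎

  val-≤-+-zeros : ∀ p d → (∀ e → e < d → letter s (p + e) ≡ 0) → val s p ≤ val s (p + d)
  val-≤-+-zeros p d σ≡0 =
    subst (val s p ≤_) (sym (val-+-zeros p d σ≡0)) (m≤n*m (val s p) (k ^ d) {{m^n≢0 k d}})

  val-shift₀ : ∀ p → p < suc m → val (shift₀ s) (suc p) + toℕ (last s) * k ^ p ≡ val s p
  val-shift₀ p p<1+m = begin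
    sum1 (suc m) F + toℕ (last s) * k ^ p  ≡⟨ cong (sum1 (suc m) F +_) G[1+p]≡σₘk^p ⟨
    sum1 (suc m) F + G (suc p)             ≡⟨ sum1-differ-at (suc m) F G (s≤s z≤n) p<1+m F≗G ⟩
    sum1 (suc m) G + F (suc p)             ≡⟨ cong (sum1 (suc m) G +_) F[1+p]≡0 ⟩
    sum1 (suc m) G + 0                     ≡⟨ +-identityʳ _ ⟩
    val s p                                ∎
    where
    F G : ℕ → ℕ
    F i = letter (shift₀ s) (suc p + suc m ∸ i) * k ^ (i ∸ 1)
    G i = letter s (p + suc m ∸ i) * k ^ (i ∸ 1)
    G[1+p]≡σₘk^p : G (suc p) ≡ toℕ (last s) * k ^ p
    G[1+p]≡σₘk^p = cong (_* k ^ p) (trans (cong (letter s) (m+[1+n]∸[1+m]≡n p m)) (letter-last s))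
    F[1+p]≡0 : F (suc p) ≡ 0
    F[1+p]≡0 = cong (_* k ^ p) (begin
      letter (shift₀ s) (suc p + suc m ∸ suc p)  ≡⟨ cong (letter (shift₀ s)) (m+n∸m≡n (suc p) (suc m)) ⟩
      letter (shift₀ s) (0 + suc m)              ≡⟨ letter-+n (shift₀ s) 0 ⟩
      letter (shift₀ s) 0                        ≡⟨ shift₀-letter-0 s ⟩
      0                                          ∎)
    -- Only the i = p + 1 summand reads position 0 of shift₀ s, the one not copied from s.
    F≗G : ∀ i → 1 ≤ i → i ≤ suc m → i ≢ suc p → F i ≡ G i
    F≗G i 1≤i i≤1+m i≢1+p = cong (_* k ^ (i ∸ 1)) (begin
      letter (shift₀ s) (suc p + suc m ∸ i)  ≡⟨ cong (letter (shift₀ s)) (+-∸-assoc 1 i≤p+1+m) ⟩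
      letter (shift₀ s) (suc x)              ≡⟨ shift₀-letter-suc s x x%≢m ⟩
      letter s x                             ∎)
      where
      i≤p+1+m : i ≤ p + suc m
      i≤p+1+m = ≤-trans i≤1+m (m≤n+m (suc m) p)
      x : ℕ
      x = p + suc m ∸ i
      x+i≡ : x + i ≡ p + suc m
      x+i≡ = m∸n+n≡m i≤p+1+m
      x<m+1+m : x < m + suc m
      x<m+1+m = <-≤-trans (m<m+n x 1≤i) (subst (_≤ m + suc m) (sym x+i≡) (+-monoˡ-≤ (suc m) (s≤s⁻¹ p<1+m)))
      x≡m⇒i≡1+p : x ≡ m → i ≡ suc p
      x≡m⇒i≡1+p x≡m = +-cancelˡ-≡ m i (suc p) (begin
        m + i        ≡⟨ cong (_+ i) x≡m ⟨
        x + i        ≡⟨ x+i≡ ⟩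
        p + suc m    ≡⟨ +-comm p (suc m) ⟩
        suc m + p    ≡⟨ +-suc m p ⟨
        m + suc p    ∎)
      x%≢m : x % suc m ≢ m
      x%≢m = i≢1+p ∘ x≡m⇒i≡1+p ∘ x%[1+m]≡m⇒x≡m x<m+1+m

record FirstBelow (c : ℕ) (P : ℕ → Bool) (r : ℕ) : Set where
  field
    bound  : r ≤ c
    before : ∀ e → e < r → P e ≡ false
    found  : r < c → P r ≡ true

open FirstBelow

firstBelow-spec : ∀ c P → FirstBelow c P (firstBelow c P)
firstBelow-spec zero    P = record { bound = z≤n ; before = λ _ () ; found = λ () }
firstBelow-spec (suc c) P with firstBelow c P | firstBelow-spec c P
... | r | ih with r ≡ᵇ c in r≡ᵇc
...   | false = record
  { bound  = m≤n⇒m≤1+n (bound ih)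
  ; before = before ih
  ; found  = λ _ → found ih (≤∧≢⇒< (bound ih) (λ r≡c → subst T r≡ᵇc (≡⇒≡ᵇ r c r≡c)))
  }
...   | true with refl ← ≡ᵇ-true⇒≡ {r} {c} r≡ᵇc with P r in Pr
...     | true  = record { bound = n≤1+n r ; before = before ih ; found = λ _ → Pr }
...     | false = record { bound = ≤-refl ; before = before′ ; found = λ r<r → contradiction refl (<⇒≢ r<r) }
  where
  before′ : ∀ e → e < suc r → P e ≡ false
  before′ e e<1+r with m<1+n⇒m<n∨m≡n e<1+r
  ... | inj₁ e<r  = before ih e e<r
  ... | inj₂ refl = Pr

firstBelow-least : ∀ c P {p} → p < c → P p ≡ true → firstBelow c P ≤ p
firstBelow-least c P {p} p<c Pp with firstBelow c P ≤? p
... | yes r≤p = r≤p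
... | no  r≰p = contradiction (trans (sym Pp) (before (firstBelow-spec c P) p (≰⇒> r≰p))) λ ()

firstBelow-≡ : ∀ c P {p} → p < c → P p ≡ true → (∀ e → e < p → P e ≡ false) → firstBelow c P ≡ p
firstBelow-≡ c P p<c Pp none-before with m≤n⇒m<n∨m≡n (firstBelow-least c P p<c Pp)
... | inj₂ r≡p = r≡p
... | inj₁ r<p = contradiction (trans (sym (none-before _ r<p)) (found (firstBelow-spec c P) (<-trans r<p p<c))) λ ()

maxBelow-upper : ∀ c (f : ℕ → ℕ) {p} → p < c → f p ≤ maxBelow c f
maxBelow-upper (suc c) f p<1+c with m<1+n⇒m<n∨m≡n p<1+c
... | inj₁ p<c  = ≤-trans (maxBelow-upper c f p<c) (m≤m⊔n _ _)
... | inj₂ refl = m≤n⊔m _ _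

maxBelow-attained : ∀ c (f : ℕ → ℕ) → ∃ λ p → p < suc c × f p ≡ maxBelow (suc c) f
maxBelow-attained zero    f = 0 , s≤s z≤n , refl
maxBelow-attained (suc c) f with maxBelow-attained c f | ≤-total (maxBelow (suc c) f) (f (suc c))
... | _ | inj₁ M≤f = suc c , ≤-refl , sym (m≤n⇒m⊔n≡n M≤f)
... | p , p<1+c , fp≡M | inj₂ f≤M = p , m≤n⇒m≤1+n p<1+c , trans fp≡M (sym (m≥n⇒m⊔n≡m f≤M))

module _ {m j : ℕ} (s : Word m j) where
  private
    M : ℕ
    M = maxBelow (suc m) (val s)
    IsMax : ℕ → Bool
    IsMax p = val s p ≡ᵇ M

    isMax : ∀ {p} → val s p ≡ M → IsMax p ≡ true
    isMax {p} vp≡M = trans (cong (val s p ≡ᵇ_) (sym vp≡M)) (≡ᵇ-refl (val s p))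

  headPos<n : headPos s < suc m
  headPos<n with maxBelow-attained m (val s)
  ... | p , p<1+m , vp≡M = ≤-<-trans (firstBelow-least (suc m) IsMax p<1+m (isMax vp≡M)) p<1+m

  headPos-max : ∀ p → p < suc m → val s p ≤ val s (headPos s)
  headPos-max p p<1+m = subst (val s p ≤_) (sym vh≡M) (maxBelow-upper (suc m) (val s) p<1+m)
    where
    vh≡M : val s (headPos s) ≡ M
    vh≡M = ≡ᵇ-true⇒≡ (found (firstBelow-spec (suc m) IsMax) headPos<n)

  headPos-least : ∀ g → g < suc m → (∀ q → q < suc m → val s q ≤ val s g) → headPos s ≤ g
  headPos-least g g<1+m g-max with maxBelow-attained m (val s)
  ... | p , p<1+m , vp≡M = firstBelow-least (suc m) IsMax g<1+m
    (isMax (≤-antisym (maxBelow-upper (suc m) (val s) g<1+m) (subst (_≤ val s g) vp≡M (g-max p p<1+m))))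

ZeroBeforeHead : ∀ {m j} → Word m j → Set
ZeroBeforeHead s = ∀ i → i < headPos s → letter s i ≡ 0

module _ {m j : ℕ} (s : Word m j) (zbh : ZeroBeforeHead s) where
  private
    k h : ℕ
    k = suc (suc j)
    h = headPos s
    h<1+m : h < suc m
    h<1+m = headPos<n s

  shift₀-zero-upto-head : ∀ i → i ≤ h → letter (shift₀ s) i ≡ 0
  shift₀-zero-upto-head zero    _     = shift₀-letter-0 s
  shift₀-zero-upto-head (suc i) i<h = trans (shift₀-letter-suc s i i%≢m) (zbh i i<h)
    where
    i<m : i < m
    i<m = <-≤-trans i<h (s≤s⁻¹ h<1+m)
    i%≢m : i % suc m ≢ m
    i%≢m i%≡m = <⇒≢ i<m (trans (sym (m<n⇒m%n≡m (m<n⇒m<1+n i<m))) i%≡m)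

  val-shift₀-upto-head≤ : ∀ q → q ≤ suc h → val (shift₀ s) q ≤ val (shift₀ s) (suc h)
  val-shift₀-upto-head≤ q q≤1+h =
    subst (val (shift₀ s) q ≤_) (cong (val (shift₀ s)) q+d≡1+h) (val-≤-+-zeros (shift₀ s) q d leading-zeros)
    where
    d : ℕ
    d = suc h ∸ q
    q+d≡1+h : q + d ≡ suc h
    q+d≡1+h = m+[n∸m]≡n q≤1+h
    leading-zeros : ∀ e → e < d → letter (shift₀ s) (q + e) ≡ 0
    leading-zeros e e<d = shift₀-zero-upto-head (q + e) (s≤s⁻¹ (subst (q + e <_) q+d≡1+h (+-monoʳ-< q e<d)))

  val-shift₀-past-head≤ : ∀ p → h ≤ p → p < suc m → val (shift₀ s) (suc p) ≤ val (shift₀ s) (suc h)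
  val-shift₀-past-head≤ p h≤p p<1+m = +-cancelʳ-≤ (c * k ^ h) a b (begin
    a + c * k ^ h  ≤⟨ +-monoʳ-≤ a (*-monoʳ-≤ c (^-monoʳ-≤ k h≤p)) ⟩
    a + c * k ^ p  ≡⟨ val-shift₀ s p p<1+m ⟩
    val s p        ≤⟨ headPos-max s p p<1+m ⟩
    val s h        ≡⟨ val-shift₀ s h h<1+m ⟨
    b + c * k ^ h  ∎)
    where
    open ≤-Reasoning
    c a b : ℕ
    c = toℕ (last s)
    a = val (shift₀ s) (suc p)
    b = val (shift₀ s) (suc h)

  val-shift₀-max : ∀ q → q < suc m → val (shift₀ s) q ≤ val (shift₀ s) (suc h)
  val-shift₀-max zero    _       = val-shift₀-upto-head≤ zero z≤n
  val-shift₀-max (suc p) 1+p<1+m with h ≤? p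
  ... | yes h≤p = val-shift₀-past-head≤ p h≤p (m<n⇒m<1+n (s≤s⁻¹ 1+p<1+m))
  ... | no  h≰p = val-shift₀-upto-head≤ (suc p) (s≤s (<⇒≤ (≰⇒> h≰p)))

  headPos-shift₀≤ : headPos (shift₀ s) ≤ suc h
  headPos-shift₀≤ with m≤n⇒m<n∨m≡n (s≤s⁻¹ h<1+m)
  ... | inj₁ h<m = headPos-least (shift₀ s) (suc h) (s≤s h<m) val-shift₀-max
  ... | inj₂ h≡m = m≤n⇒m≤1+n (subst (headPos (shift₀ s) ≤_) (sym h≡m) (s≤s⁻¹ (headPos<n (shift₀ s))))

  ZeroBeforeHead-shift₀ : ZeroBeforeHead (shift₀ s)
  ZeroBeforeHead-shift₀ i i<h′ = shift₀-zero-upto-head i (s≤s⁻¹ (<-≤-trans i<h′ headPos-shift₀≤))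

isZeroWord-false : ∀ {m j} {s : Word m j} → s ≢ zeros → isZeroWord s ≡ false
isZeroWord-false {s = s} s≢0 = trans (isYes≗does s≟0) (dec-false s≟0 s≢0)
  where
  s≟0 : Dec (s ≡ zeros)
  s≟0 = ≡-dec _≟ᶠ_ s zeros

module _ {m j : ℕ} (s : Word m j) where
  private
    h : ℕ
    h = headPos s
    h<1+m : h < suc m
    h<1+m = headPos<n s

    tailSearch : ℕ → Bool
    tailSearch e = not (letter s (h + suc m ∸ suc e) ≡ᵇ 0)

    hit : ℕ
    hit = firstBelow (suc m) tailSearch

    letter-before-head : ∀ {i e} → i + suc e ≡ h → letter s (h + suc m ∸ suc e) ≡ letter s i
    letter-before-head {i} {e} i+1+e≡h =
      trans (cong (λ x → letter s (x + suc m ∸ suc e)) (sym i+1+e≡h))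
            (trans (cong (letter s) (m+n+o∸n≡m+o i (suc e) (suc m))) (letter-+n s i))

  Atail-true : ZeroBeforeHead s → s ≢ zeros → letter s m ≢ 0 → Atail s ≡ true
  Atail-true zbh s≢0 σₘ≢0 =
    trans (cong₂ (λ z r → not z ∧ (r ≡ᵇ m)) (isZeroWord-false s≢0) tailPos≡m) (≡ᵇ-refl m)
    where
    found-at-head : tailSearch h ≡ true
    found-at-head = trans (cong (λ x → not (letter s x ≡ᵇ 0)) (m+[1+n]∸[1+m]≡n h m)) (≢0⇒not[≡ᵇ0] σₘ≢0)
    none-before : ∀ e → e < h → tailSearch e ≡ false
    none-before e e<h = cong (λ x → not (x ≡ᵇ 0)) (trans (letter-before-head i+1+e≡h) (zbh i i<h))
      where
      i : ℕ
      i = h ∸ suc e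
      i+1+e≡h : i + suc e ≡ h
      i+1+e≡h = m∸n+n≡m e<h
      i<h : i < h
      i<h = ∸-monoʳ-< z<s e<h
    hit≡h : hit ≡ h
    hit≡h = firstBelow-≡ (suc m) tailSearch h<1+m found-at-head none-before
    tailPos≡m : tailPos s ≡ m
    tailPos≡m = begin
      (h + suc m ∸ suc hit) % suc m  ≡⟨ cong (λ x → (h + suc m ∸ suc x) % suc m) hit≡h ⟩
      (h + suc m ∸ suc h) % suc m  ≡⟨ cong (_% suc m) (m+[1+n]∸[1+m]≡n h m) ⟩
      m % suc m                    ≡⟨ m≤n⇒m%n≡m ≤-refl ⟩
      m                            ∎
      where open ≡-Reasoning

  Atail⇒ZeroBeforeHead : Atail s ≡ true → ZeroBeforeHead s
  Atail⇒ZeroBeforeHead Atail≡true i i<h = begin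
    letter s i                          ≡⟨ letter-before-head i+1+e≡h ⟨
    letter s (h + suc m ∸ suc e)        ≡⟨ not[≡ᵇ0]≡false⇒≡0 e-missed ⟩
    0                                   ∎
    where
    open ≡-Reasoning
    tailPos≡m : tailPos s ≡ m
    tailPos≡m = ≡ᵇ-true⇒≡ (∧-conicalʳ _ _ Atail≡true)
    -- If the search stopped before reaching the head, the tail would lie strictly before the head, hence below n - 1.
    h≤hit : h ≤ hit
    h≤hit with h ≤? hit
    ... | yes h≤hit = h≤hit
    ... | no  h≰hit = contradiction (trans (sym tailPos≡r) tailPos≡m) (<⇒≢ r<m)
      where
      hit<h : hit < h
      hit<h = ≰⇒> h≰hit
      r : ℕ
      r = h ∸ suc hit
      r<m : r < m
      r<m = <-≤-trans (∸-monoʳ-< z<s hit<h) (s≤s⁻¹ h<1+m)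
      tailPos≡r : tailPos s ≡ r
      tailPos≡r = begin
        (h + suc m ∸ suc hit) % suc m  ≡⟨ cong (_% suc m) (+-∸-comm (suc m) hit<h) ⟩
        (r + suc m) % suc m          ≡⟨ [m+n]%n≡m%n r (suc m) ⟩
        r % suc m                    ≡⟨ m<n⇒m%n≡m (m<n⇒m<1+n r<m) ⟩
        r                            ∎
    e : ℕ
    e = h ∸ suc i
    e<h : e < h
    e<h = ∸-monoʳ-< z<s i<h
    e-missed : tailSearch e ≡ false
    e-missed = before (firstBelow-spec (suc m) tailSearch) e (<-≤-trans e<h h≤hit)
    i+1+e≡h : i + suc e ≡ h
    i+1+e≡h = trans (+-suc i e) (m+[n∸m]≡n i<h)

step-pass : ∀ {m j} (B : Word m j → Bool) (s : Word m j) →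
            B s ≡ false → s ≢ zeros → ZeroBeforeHead s → step B Atail s ≡ shift₀ s
step-pass {m} B s Bs≡false s≢0 zbh rewrite Bs≡false with Atail s in Atail≡
... | true  = refl
... | false = cong (_∷ init s) (toℕ-injective (trans (sym (letter-last s)) σₘ≡0))
  where
  σₘ≡0 : letter s m ≡ 0
  σₘ≡0 with letter s m ≟ 0
  ... | yes σₘ≡0 = σₘ≡0
  ... | no  σₘ≢0 = contradiction (trans (sym Atail≡) (Atail-true s zbh s≢0 σₘ≢0)) λ ()

module _ {m j : ℕ} (B : Word m j → Bool) {t₁ t₂ : ℕ}
         (fires : Atail (state B Atail t₁) ≡ true)
         (passes : ∀ t → t₁ ≤ t → t < t₂ → B (state B Atail t) ≡ false)
         (nonzero : ∀ t → t₁ ≤ t → t < t₂ → state B Atail t ≢ zeros) where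
  private
    S : ℕ → Word m j
    S = state B Atail

    ZeroBeforeHead-after : ∀ d → d + t₁ < t₂ → ZeroBeforeHead (S (d + t₁))
    shift₀-after : ∀ d → d + t₁ < t₂ → S (suc (d + t₁)) ≡ shift₀ (S (d + t₁))

    ZeroBeforeHead-after zero    _   = Atail⇒ZeroBeforeHead (S t₁) fires
    ZeroBeforeHead-after (suc d) d<t₂ =
      subst ZeroBeforeHead (sym (shift₀-after d d′<t₂))
            (ZeroBeforeHead-shift₀ (S (d + t₁)) (ZeroBeforeHead-after d d′<t₂))
      where
      d′<t₂ : d + t₁ < t₂
      d′<t₂ = <-trans (n<1+n (d + t₁)) d<t₂

    shift₀-after d d<t₂ =
      step-pass B (S (d + t₁)) (passes _ t₁≤ d<t₂) (nonzero _ t₁≤ d<t₂) (ZeroBeforeHead-after d d<t₂)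
      where
      t₁≤ : t₁ ≤ d + t₁
      t₁≤ = m≤n+m t₁ d

  shift₀-while-passing : ∀ t → t₁ ≤ t → t < t₂ → S (suc t) ≡ shift₀ (S t)
  shift₀-while-passing t t₁≤t t<t₂ =
    subst (λ u → S (suc u) ≡ shift₀ (S u)) d+t₁≡t
          (shift₀-after (t ∸ t₁) (subst (_< t₂) (sym d+t₁≡t) t<t₂))
    where
    d+t₁≡t : t ∸ t₁ + t₁ ≡ t
    d+t₁≡t = m∸n+n≡m t₁≤t

claim28 : (m j : ℕ) (B : Word m j → Bool) → IsBobStrategy B →
    (t₀ t₁ t₂ : ℕ) → t₀ < t₁ → t₁ < t₂ → IsIndex B Atail t₂ →
    B (state B Atail t₀) ≡ true → B (state B Atail t₂) ≡ true →
    Atail (state B Atail t₁) ≡ true →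
    (∀ t → t₀ < t → t < t₂ → B (state B Atail t) ≡ false) →
    ∀ t′ → t₁ < t′ → t′ ≤ t₂ →
      ∃ λ (x : Vec (Fin (suc (suc j))) m) → state B Atail t′ ≡ Fin.zero ∷ x
claim28 m j B _ t₀ t₁ t₂ t₀<t₁ _ index _ _ Atail₁ passes (suc t) t₁<1+t 1+t≤t₂ =
  init (state B Atail t) , shift₀-while-passing B Atail₁ passes′ nonzero t (s≤s⁻¹ t₁<1+t) 1+t≤t₂
  where
  passes′ : ∀ t → t₁ ≤ t → t < t₂ → B (state B Atail t) ≡ false
  passes′ t t₁≤t = passes t (<-≤-trans t₀<t₁ t₁≤t)
  nonzero : ∀ t → t₁ ≤ t → t < t₂ → state B Atail t ≢ zeros
  nonzero t t₁≤t = index t (≤-<-trans z≤n (<-≤-trans t₀<t₁ t₁≤t))
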